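{- Let $B$ be a positive integer and $n$ an odd integer. If $p$ is a prime such that $p^2$ divides $n$, then $n$ passes the Random Quadratic Frobenius Test with probability less than $\frac4p$.
   Context: Fix a positive integer $B$. Let $n>1$ be odd and let $b,c$ be integers with $\left(\frac{b^2+4c}{n}\right)=-1$ and $\left(\frac{ -c}{n}\right)=1$. The Quadratic Frobenius Test (QFT) with parameters $(b,c)$ on $n$, with computations in $R=(\mathbb{Z}/n\mathbb{Z})[x]/(x^2-bx-c)$: (1) if $n$ is divisible by a prime $\le\min\{B,\sqrt n\}$, declare composite and stop; (2) if $\sqrt n\in\mathbb{Z}$, declare composite and stop; (3) if $x^{(n+1)/2}\notin\mathbb{Z}/n\mathbb{Z}$ in $R$, declare composite and stop; (4) if $x^{n+1}\ne -c$ in $R$, declare composite and stop; (5) writing $n^2-1=2^rs$ with $s$ odd, if $x^s\ne1$ and $x^{2^js}\ne-1$ in $R$ for all $0\le j\le r-2$, declare composite and stop. Otherwise $n$ passes the QFT with parameters $(b,c)$. Let $M(n)$ be the number of pairs $(b,c)$ of residues modulo $n$ such that either $\left(\frac{b^2+4c}{n}\right)=-1$ and $\left(\frac{ -c}{n}\right)=1$, or $1<\gcd(b^2+4c,n)<n$, or $1<\gcd(c,n)<n$. We say $n$ passes the Random Quadratic Frobenius Test with probability $\alpha$ if the number of pairs $(b,c)$ of residues modulo $n$ such that $n$ passes the QFT with parameters $(b,c)$ equals $\alpha M(n)$. -}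

module Defs where

open import Data.Nat.Base using (ℕ; zero; suc; _+_; _*_; _∸_; _^_; NonZero; _≤ᵇ_; _<ᵇ_; _≡ᵇ_)
open import Data.Nat.DivMod using (_%_; _/_)
open import Data.Nat.Divisibility using (_∣?_)
open import Data.Nat.GCD using (gcd)
open import Data.Nat.Primality using (prime?)
open import Data.Integer.Base using (ℤ; +_; -[1+_]) renaming (_*_ to _*ℤ_)
import Data.Integer.Properties as ℤP
open import Data.Bool.Base using (Bool; true; false; _∧_; _∨_; not; if_then_else_)
open import Data.List.Base using (List; []; _∷_; upTo; concatMap; map)
open import Data.Bool.ListAction using (any)
open import Data.Product.Base using (_×_; _,_; proj₁; proj₂)
open import Relation.Nullary.Decidable.Core using (does)

infix 4 _==ℤ_
_==ℤ_ : ℤ → ℤ → Bool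
x ==ℤ y = does (x ℤP.≟ y)

legendre : ℕ → ℕ → ℤ
legendre a zero = + 0
legendre a (suc k) =
  if (a % suc k) ≡ᵇ 0 then + 0
  else if any (λ x → ((x * x) % suc k) ≡ᵇ (a % suc k)) (upTo (suc k)) then + 1
  else -[1+ 0 ]

firstDiv : ℕ → ℕ → ℕ → ℕ
firstDiv zero d m = m
firstDiv (suc f) d m = if does (d ∣? m) then d else firstDiv f (suc d) m

spf : ℕ → ℕ
spf m = firstDiv m 2 m

-- Jacobi symbol via prime factorisation: (a/m) = (a/q) (a/(m/q)), q = spf m.
-- The fuel argument is always sufficient (m at least halves at each step).
jacGo : ℕ → ℕ → ℕ → ℤ
jacGo zero a m = + 1
jacGo (suc f) a m with m ≤ᵇ 1 | spf m
... | true  | _ = + 1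
... | false | zero = + 1
... | false | suc k = legendre a (suc k) *ℤ jacGo f a (m / suc k)

jacobi : ℕ → ℕ → ℤ
jacobi a m = jacGo m a m

-- 2-adic splitting: split fuel m = (r , s) with m = 2^r * s, s odd (for m > 0).
split : ℕ → ℕ → ℕ × ℕ
split zero m = (0 , m)
split (suc f) m =
  if m ≡ᵇ 0 then (0 , m)
  else if (m % 2) ≡ᵇ 0 then (suc (proj₁ (split f (m / 2))) , proj₂ (split f (m / 2)))
  else (0 , m)

count : {A : Set} → (A → Bool) → List A → ℕ
count p [] = 0
count p (x ∷ xs) = if p x then suc (count p xs) else count p xs

pairs : ℕ → List (ℕ × ℕ)
pairs n = concatMap (λ b → map (λ c → (b , c)) (upTo n)) (upTo n)

module _ (n : ℕ) .{{_ : NonZero n}} where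

  -- elements u + v x of R = (ℤ/n)[x]/(x² - b x - c), as reduced pairs (u , v)
  R : Set
  R = ℕ × ℕ

  mulR : ℕ → ℕ → R → R → R
  mulR b c (u₁ , v₁) (u₂ , v₂) =
    ((u₁ * u₂ + c * (v₁ * v₂)) % n , (u₁ * v₂ + v₁ * u₂ + b * (v₁ * v₂)) % n)

  eqR : R → R → Bool
  eqR (u₁ , v₁) (u₂ , v₂) = (u₁ ≡ᵇ u₂) ∧ (v₁ ≡ᵇ v₂)

  oneR : R
  oneR = (1 % n , 0)

  negOneR : R
  negOneR = ((n ∸ 1) % n , 0)

  negCR : ℕ → R
  negCR c = ((n ∸ (c % n)) % n , 0)

  xR : R
  xR = (0 , 1 % n)

  powX : ℕ → ℕ → ℕ → R
  powX b c zero = oneR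
  powX b c (suc k) = mulR b c xR (powX b c k)

  qftParams : ℕ → ℕ → Bool
  qftParams b c = (jacobi ((b * b + 4 * c) % n) n ==ℤ -[1+ 0 ])
                ∧ (jacobi ((n ∸ (c % n)) % n) n ==ℤ (+ 1))

  -- step (1) fails: n divisible by a prime q ≤ min{B, √n}  (q ≤ √n ⟺ q² ≤ n)
  smallPrimeDiv : ℕ → Bool
  smallPrimeDiv B = any (λ q → does (prime? q) ∧ does (q ∣? n) ∧ (q ≤ᵇ B) ∧ (q * q ≤ᵇ n))
                        (upTo (suc B))

  isSquare : Bool
  isSquare = any (λ k → (k * k) ≡ᵇ n) (upTo (suc n))

  -- step (3) ok: x^((n+1)/2) ∈ ℤ/n
  step3 : ℕ → ℕ → Bool
  step3 b c = proj₂ (powX b c ((n + 1) / 2)) ≡ᵇ 0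

  step4 : ℕ → ℕ → Bool
  step4 b c = eqR (powX b c (n + 1)) (negCR c)

  step5 : ℕ → ℕ → Bool
  step5 b c =
    let m = n * n ∸ 1
        r = proj₁ (split m m)
        s = proj₂ (split m m)
    in eqR (powX b c s) oneR
       ∨ any (λ j → eqR (powX b c (2 ^ j * s)) negOneR) (upTo (r ∸ 1))

  passesQFT : ℕ → ℕ → ℕ → Bool
  passesQFT B b c = qftParams b c ∧ not (smallPrimeDiv B) ∧ not isSquare
                    ∧ step3 b c ∧ step4 b c ∧ step5 b c

  passCount : ℕ → ℕ
  passCount B = count (λ bc → passesQFT B (proj₁ bc) (proj₂ bc)) (pairs n)

  nontrivGcd : ℕ → Bool
  nontrivGcd a = (1 <ᵇ gcd a n) ∧ (gcd a n <ᵇ n)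

  M : ℕ
  M = count (λ bc → qftParams (proj₁ bc) (proj₂ bc)
                    ∨ nontrivGcd (proj₁ bc * proj₁ bc + 4 * proj₂ bc)
                    ∨ nontrivGcd (proj₂ bc))
            (pairs n)

-- Write n = m p with p ∣ m, and sort the pairs (b , c) by c and by b mod m.  Within one class
-- {b₀ + i m : i < p} all b have the same Jacobi symbols modulo n, because every prime factor
-- of n divides m; so if one of them passes the test, all p pairs of the class count towards M(n).
-- At most one of them passes.  If b and b + t m (0 < t < p) both give x^(n+1) = −c, expand the
-- x-coefficient of x^(n+1) to first order in the shift t m, whose square vanishes modulo n: p
-- divides its b-derivative.  The identity (b² + 4c) ∂U/∂b + b U = K (b U + 2 V), for
-- x^K = V + U x, then forces p ∣ V, hence p ∣ c, and then no power of x is ±1, so step (5)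
-- fails.  Hence p · passCount ≤ M(n), and M(n) > 0 because gcd(p, n) = p is nontrivial.

module Submission where

open import Data.Bool.Base using (Bool; true; false; T; _∧_; _∨_; not)
open import Data.Bool.Properties using (T-∧; T-∨)
open import Data.Integer.Base using (1ℤ; -1ℤ) renaming (_*_ to _*ℤ_)
open import Data.List.Base using (List; []; _∷_; _++_; map; applyUpTo; upTo; concatMap)
open import Data.List.Relation.Unary.Any using (satisfied)
open import Data.List.Relation.Unary.Any.Properties using (any⁻)
open import Data.Nat.Base
open import Data.Nat.Divisibility
open import Data.Nat.DivMod
open import Data.Nat.GCD using (gcd; gcd[m,n]∣m; gcd-greatest)
open import Data.Nat.Primality
open import Data.Nat.Properties
open import Algebra.Properties.CommutativeSemigroup +-commutativeSemigroup
  using () renaming (interchange to +-interchange)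
open import Data.Nat.Tactic.RingSolver using (solve-∀)
open import Data.Product.Base using (_×_; _,_; proj₁; proj₂; ∃-syntax)
open import Data.Sum.Base using (inj₁; inj₂; [_,_]′)
open import Function.Base using (id; _∘_; it)
open import Function.Bundles using (Equivalence)
open import Relation.Binary.PropositionalEquality
open import Relation.Nullary.Decidable.Core using (yes; no)
open import Relation.Nullary.Negation using (¬_; contradiction)

open import Defs

-- Finite sums

∑ : ℕ → (ℕ → ℕ) → ℕ
∑ zero    f = 0
∑ (suc k) f = f 0 + ∑ k (λ i → f (suc i))

infix 1 ∑
syntax ∑ k (λ i → f) = ∑[ i < k ] f

∑-cong : ∀ k {f g} → (∀ i → i < k → f i ≡ g i) → ∑ k f ≡ ∑ k g
∑-cong zero    eq = refl
∑-cong (suc k) eq = cong₂ _+_ (eq 0 z<s) (∑-cong k (λ i i<k → eq (suc i) (s<s i<k)))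

∑-mono-≤ : ∀ k {f g} → (∀ i → i < k → f i ≤ g i) → ∑ k f ≤ ∑ k g
∑-mono-≤ zero    le = z≤n
∑-mono-≤ (suc k) le = +-mono-≤ (le 0 z<s) (∑-mono-≤ k (λ i i<k → le (suc i) (s<s i<k)))

term≤∑ : ∀ k f {i} → i < k → f i ≤ ∑ k f
term≤∑ (suc k) f {zero}  _         = m≤m+n (f 0) _
term≤∑ (suc k) f {suc i} (s<s i<k) = ≤-trans (term≤∑ k (λ j → f (suc j)) i<k) (m≤n+m _ (f 0))

∑-zero : ∀ k → (∑[ i < k ] 0) ≡ 0
∑-zero zero    = refl
∑-zero (suc k) = ∑-zero k

∑-distrib-+ : ∀ k f g → (∑[ i < k ] f i + g i) ≡ ∑ k f + ∑ k g
∑-distrib-+ zero    f g = refl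
∑-distrib-+ (suc k) f g = begin
  f 0 + g 0 + (∑[ i < k ] f (suc i) + g (suc i))
    ≡⟨ cong (f 0 + g 0 +_) (∑-distrib-+ k (λ i → f (suc i)) (λ i → g (suc i))) ⟩
  f 0 + g 0 + ((∑[ i < k ] f (suc i)) + (∑[ i < k ] g (suc i)))
    ≡⟨ +-interchange (f 0) (g 0) _ _ ⟩
  f 0 + (∑[ i < k ] f (suc i)) + (g 0 + (∑[ i < k ] g (suc i))) ∎
  where open ≡-Reasoning
  
*-distribˡ-∑ : ∀ c k f → c * ∑ k f ≡ (∑[ i < k ] c * f i)
*-distribˡ-∑ c zero    f = *-zeroʳ c
*-distribˡ-∑ c (suc k) f = trans (*-distribˡ-+ c (f 0) _) (cong (c * f 0 +_) (*-distribˡ-∑ c k _))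

∑-+ : ∀ a b f → ∑ (a + b) f ≡ ∑ a f + (∑[ j < b ] f (a + j))
∑-+ zero    b f = refl
∑-+ (suc a) b f = trans (cong (f 0 +_) (∑-+ a b (λ k → f (suc k)))) (sym (+-assoc (f 0) _ _))

∑-* : ∀ a b f → ∑ (a * b) f ≡ (∑[ i < a ] ∑[ j < b ] f (i * b + j))
∑-* zero    b f = refl
∑-* (suc a) b f = trans (∑-+ b (a * b) f) (cong (∑ b f +_) (trans (∑-* a b (λ k → f (b + k)))
  (∑-cong a (λ i _ → ∑-cong b (λ j _ → cong f (sym (+-assoc b (i * b) j)))))))

∑-comm : ∀ a b (f : ℕ → ℕ → ℕ) →
         (∑[ i < a ] ∑[ j < b ] f i j) ≡ (∑[ j < b ] ∑[ i < a ] f i j)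
∑-comm zero    b f = sym (∑-zero b)
∑-comm (suc a) b f = trans (cong (∑ b (f 0) +_) (∑-comm a b (λ i → f (suc i))))
  (sym (∑-distrib-+ b (f 0) (λ j → ∑[ i < a ] f (suc i) j)))

∑-residue-classes : ∀ p m N (F : ℕ → ℕ → ℕ) →
  (∑[ b < p * m ] ∑[ c < N ] F b c) ≡ (∑[ j < m ] ∑[ c < N ] ∑[ i < p ] F (i * m + j) c)
∑-residue-classes p m N F = begin
  (∑[ b < p * m ] ∑[ c < N ] F b c)
    ≡⟨ ∑-* p m (λ b → ∑[ c < N ] F b c) ⟩
  (∑[ i < p ] ∑[ j < m ] ∑[ c < N ] F (i * m + j) c)
    ≡⟨ ∑-comm p m (λ i j → ∑[ c < N ] F (i * m + j) c) ⟩
  (∑[ j < m ] ∑[ i < p ] ∑[ c < N ] F (i * m + j) c)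
    ≡⟨ ∑-cong m (λ j _ → ∑-comm p N (λ i c → F (i * m + j) c)) ⟩
  (∑[ j < m ] ∑[ c < N ] ∑[ i < p ] F (i * m + j) c)
    ∎
  where open ≡-Reasoning

𝟙 : Bool → ℕ
𝟙 true  = 1
𝟙 false = 0

T-∨ˡ : ∀ {x} y → T x → T (x ∨ y)
T-∨ˡ {true} y _ = _

T-∨ʳ : ∀ x {y} → T y → T (x ∨ y)
T-∨ʳ true  _  = _
T-∨ʳ false ty = ty

T⇒1≤𝟙 : ∀ {x} → T x → 1 ≤ 𝟙 x
T⇒1≤𝟙 {true} _ = s≤s z≤n

∑𝟙-≡0 : ∀ k (P : ℕ → Bool) → (∀ i → i < k → ¬ T (P i)) → (∑[ i < k ] 𝟙 (P i)) ≡ 0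
∑𝟙-≡0 zero    P never = refl
∑𝟙-≡0 (suc k) P never with P 0 in e
... | true  = contradiction (subst T (sym e) _) (never 0 z<s)
... | false = ∑𝟙-≡0 k (λ i → P (suc i)) (λ i i<k → never (suc i) (s<s i<k))

∑𝟙-≡k : ∀ k (P : ℕ → Bool) → (∀ i → i < k → T (P i)) → (∑[ i < k ] 𝟙 (P i)) ≡ k
∑𝟙-≡k zero    P always = refl
∑𝟙-≡k (suc k) P always with P 0 | always 0 z<s
... | true | _ = cong suc (∑𝟙-≡k k (λ i → P (suc i)) (λ i i<k → always (suc i) (s<s i<k)))

∑𝟙-≤1 : ∀ k (P : ℕ → Bool) → (∀ i j → i < j → j < k → T (P i) → ¬ T (P j)) →
        (∑[ i < k ] 𝟙 (P i)) ≤ 1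
∑𝟙-≤1 zero    P once = z≤n
∑𝟙-≤1 (suc k) P once with P 0 in e
... | true  = ≤-reflexive (cong suc (∑𝟙-≡0 k (λ i → P (suc i))
                (λ i i<k → once 0 (suc i) z<s (s<s i<k) (subst T (sym e) _))))
... | false = ∑𝟙-≤1 k (λ i → P (suc i)) (λ i j i<j j<k → once (suc i) (suc j) (s<s i<j) (s<s j<k))

∑𝟙-witness : ∀ k (P : ℕ → Bool) → 0 < (∑[ i < k ] 𝟙 (P i)) → ∃[ i ] i < k × T (P i)
∑𝟙-witness (suc k) P pos with P 0 in e
... | true  = 0 , z<s , subst T (sym e) _
... | false with ∑𝟙-witness k (λ i → P (suc i)) pos
...   | i , i<k , Pi = suc i , s<s i<k , Pi

unique⇒*-∑𝟙-≤ : ∀ k (P Q : ℕ → Bool) → (∀ i j → i < j → j < k → T (P i) → ¬ T (P j)) →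
                (∀ i j → i < k → j < k → T (P i) → T (Q j)) →
                k * (∑[ i < k ] 𝟙 (P i)) ≤ (∑[ i < k ] 𝟙 (Q i))
unique⇒*-∑𝟙-≤ k P Q once spread with ∑[ i < k ] 𝟙 (P i) in e
... | zero  = ≤-trans (≤-reflexive (*-zeroʳ k)) z≤n
... | suc x with ∑𝟙-witness k P (subst (0 <_) (sym e) z<s)
...   | i , i<k , Pi = begin
  k * suc x                ≤⟨ *-monoʳ-≤ k (subst (_≤ 1) e (∑𝟙-≤1 k P once)) ⟩
  k * 1                    ≡⟨ *-identityʳ k ⟩
  k                        ≡⟨ ∑𝟙-≡k k Q (λ j j<k → spread i j i<k j<k Pi) ⟨
  (∑[ i < k ] 𝟙 (Q i))     ∎
  where open ≤-Reasoning

count-++ : ∀ {A : Set} P (xs ys : List A) → count P (xs ++ ys) ≡ count P xs + count P ys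
count-++ P []       ys = refl
count-++ P (x ∷ xs) ys with P x
... | true  = cong suc (count-++ P xs ys)
... | false = count-++ P xs ys

count-map : ∀ {A B : Set} P (g : A → B) xs → count P (map g xs) ≡ count (λ x → P (g x)) xs
count-map P g []       = refl
count-map P g (x ∷ xs) with P (g x)
... | true  = cong suc (count-map P g xs)
... | false = count-map P g xs

count-applyUpTo : ∀ {A : Set} P (f : ℕ → A) k → count P (applyUpTo f k) ≡ (∑[ i < k ] 𝟙 (P (f i)))
count-applyUpTo P f zero    = refl
count-applyUpTo P f (suc k) with P (f 0)
... | true  = cong suc (count-applyUpTo P (λ i → f (suc i)) k)
... | false = count-applyUpTo P (λ i → f (suc i)) k

count-concatMap : ∀ {A B : Set} P (h : A → List B) (f : ℕ → A) k →
                  count P (concatMap h (applyUpTo f k)) ≡ (∑[ i < k ] count P (h (f i)))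
count-concatMap P h f zero    = refl
count-concatMap P h f (suc k) = trans (count-++ P (h (f 0)) _)
  (cong (count P (h (f 0)) +_) (count-concatMap P h (λ i → f (suc i)) k))

count-pairs : ∀ P n → count P (pairs n) ≡ (∑[ b < n ] ∑[ c < n ] 𝟙 (P (b , c)))
count-pairs P n = trans (count-concatMap P _ (λ i → i) n) (∑-cong n (λ b _ →
  trans (count-map P (b ,_) (upTo n)) (count-applyUpTo _ (λ i → i) n)))

prime⇒∤1 : ∀ {p} → Prime p → ¬ p ∣ 1
prime⇒∤1 p-prime p∣1 = nonTrivial⇒≢1 {{prime⇒nonTrivial p-prime}} (∣1⇒≡1 p∣1)

∣m*n∧∤m⇒∣n : ∀ {p m n} → Prime p → p ∣ m * n → ¬ p ∣ m → p ∣ n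
∣m*n∧∤m⇒∣n {m = m} {n} p-prime p∣mn p∤m =
  [ (λ p∣m → contradiction p∣m p∤m) , id ]′ (euclidsLemma m n p-prime p∣mn)

∣m*p⇒∣m : ∀ {p q m} → Prime p → Prime q → p ∣ m → q ∣ m * p → q ∣ m
∣m*p⇒∣m p-prime q-prime p∣m q∣mp with euclidsLemma _ _ q-prime q∣mp
... | inj₁ q∣m = q∣m
... | inj₂ q∣p with prime⇒irreducible p-prime q∣p
...   | inj₁ refl = contradiction (∣-refl) (prime⇒∤1 q-prime)
...   | inj₂ refl = p∣m

-- x ^ k = coeff₀ b c k + coeff₁ b c k · x  in  ℤ[x]/(x² − b x − c).
coeff₀ coeff₁ : ℕ → ℕ → ℕ → ℕ
coeff₀ b c zero    = 1
coeff₀ b c (suc k) = c * coeff₁ b c k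
coeff₁ b c zero    = 0
coeff₁ b c (suc k) = coeff₀ b c k + b * coeff₁ b c k

∂coeff₀ ∂coeff₁ : ℕ → ℕ → ℕ → ℕ
∂coeff₀ b c zero    = 0
∂coeff₀ b c (suc k) = c * ∂coeff₁ b c k
∂coeff₁ b c zero    = 0
∂coeff₁ b c (suc k) = ∂coeff₀ b c k + b * ∂coeff₁ b c k + coeff₁ b c k

coeffRem₀ coeffRem₁ : ℕ → ℕ → ℕ → ℕ → ℕ
coeffRem₀ b c δ zero    = 0
coeffRem₀ b c δ (suc k) = c * coeffRem₁ b c δ k
coeffRem₁ b c δ zero    = 0
coeffRem₁ b c δ (suc k) =
  coeffRem₀ b c δ k + b * coeffRem₁ b c δ k + ∂coeff₁ b c k + δ * coeffRem₁ b c δ k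

coeff-taylor : ∀ b c δ k →
  (coeff₀ (b + δ) c k ≡ coeff₀ b c k + δ * ∂coeff₀ b c k + δ * δ * coeffRem₀ b c δ k) ×
  (coeff₁ (b + δ) c k ≡ coeff₁ b c k + δ * ∂coeff₁ b c k + δ * δ * coeffRem₁ b c δ k)
coeff-taylor b c δ zero    = base 1 δ , base 0 δ
  where
  base : ∀ x δ → x ≡ x + δ * 0 + δ * δ * 0
  base = solve-∀
coeff-taylor b c δ (suc k) with coeff-taylor b c δ k
... | taylor₀ , taylor₁ =
  trans (cong (c *_) taylor₁) (step₀ c _ _ _ δ) ,
  trans (cong₂ (λ x y → x + (b + δ) * y) taylor₀ taylor₁) (step₁ _ _ _ _ _ _ b δ)
  where
  step₀ : ∀ c B ∂B R δ → c * (B + δ * ∂B + δ * δ * R) ≡ c * B + δ * (c * ∂B) + δ * δ * (c * R)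
  step₀ = solve-∀
  step₁ : ∀ A ∂A R₀ B ∂B R₁ b δ →
    (A + δ * ∂A + δ * δ * R₀) + (b + δ) * (B + δ * ∂B + δ * δ * R₁)
    ≡ (A + b * B) + δ * (∂A + b * ∂B + B) + δ * δ * (R₀ + b * R₁ + ∂B + δ * R₁)
  step₁ = solve-∀

-- Differentiate x ^ k in b using ∂x/∂b = x/(2x − b) and (2x − b)² = b² + 4c,
-- then compare coefficients of x.
discriminant-∂coeff₁ : ∀ b c k →
  (b * b + 4 * c) * ∂coeff₁ b c k + b * coeff₁ b c k ≡ k * (b * coeff₁ b c k + 2 * coeff₀ b c k)
discriminant-∂coeff₁ b c zero          = base b c
  where
  base : ∀ b c → (b * b + 4 * c) * 0 + b * 0 ≡ 0
  base = solve-∀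
discriminant-∂coeff₁ b c (suc zero)    = base b c
  where
  base : ∀ b c → (b * b + 4 * c) * (0 + b * 0 + 0) + b * (1 + b * 0) ≡ 1 * (b * (1 + b * 0) + 2 * (c * 0))
  base = solve-∀
discriminant-∂coeff₁ b c (suc (suc k)) = +-cancelʳ-≡ _ _ _ (begin
  D * (c * ∂B + b * ∂B′ + B′) + b * B″ + b * B″
    ≡⟨ regroup b c D ∂B ∂B′ B B′ ⟩
  c * (D * ∂B + b * B) + b * (D * ∂B′ + b * B′) + D * B′ + b * B″
    ≡⟨ cong₂ (λ x y → c * x + b * y + D * B′ + b * B″)
             (discriminant-∂coeff₁ b c k) (discriminant-∂coeff₁ b c (suc k)) ⟩
  c * (k * (b * B + 2 * A)) + b * (suc k * (b * B′ + 2 * (c * B))) + D * B′ + b * B″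
    ≡⟨ cong (_+ b * B″) (collect k b c A B) ⟩
  suc (suc k) * (b * B″ + 2 * (c * B′)) + b * B″ ∎)
  where
  open ≡-Reasoning
  D A B B′ B″ ∂B ∂B′ : ℕ
  D = b * b + 4 * c
  A = coeff₀ b c k
  B = coeff₁ b c k
  B′ = coeff₁ b c (suc k)
  B″ = coeff₁ b c (suc (suc k))
  ∂B = ∂coeff₁ b c k
  ∂B′ = ∂coeff₁ b c (suc k)
  regroup : ∀ b c D ∂B ∂B′ B B′ →
    D * (c * ∂B + b * ∂B′ + B′) + b * (c * B + b * B′) + b * (c * B + b * B′)
    ≡ c * (D * ∂B + b * B) + b * (D * ∂B′ + b * B′) + D * B′ + b * (c * B + b * B′)
  regroup = solve-∀
  collect : ∀ k b c A B →
    c * (k * (b * B + 2 * A)) + b * (suc k * (b * (A + b * B) + 2 * (c * B))) + (b * b + 4 * c) * (A + b * B)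
    ≡ suc (suc k) * (b * (c * B + b * (A + b * B)) + 2 * (c * (A + b * B)))
  collect = solve-∀

p∣∂coeff₁ : ∀ {p m t} .{{_ : NonZero m}} b c K → Prime p → p ∣ m → ¬ p ∣ t →
            m * p ∣ coeff₁ b c K → m * p ∣ coeff₁ (b + t * m) c K → p ∣ ∂coeff₁ b c K
p∣∂coeff₁ {p} {m} {t} b c K p-prime p∣m p∤t mp∣X mp∣X′ =
  ∣m*n∧∤m⇒∣n p-prime (*-cancelˡ-∣ m mp∣mtY) p∤t
  where
  X Y Z : ℕ
  X = coeff₁ b c K
  Y = ∂coeff₁ b c K
  Z = coeffRem₁ b c (t * m) K
  -- δ = t m and m p ∣ m², so the second-order term drops out modulo m p.
  regroup : ∀ X Y Z t m → X + t * m * Y + t * m * (t * m) * Z ≡ X + m * m * (t * t * Z) + m * (t * Y)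
  regroup = solve-∀
  mp∣mtY : m * p ∣ m * (t * Y)
  mp∣mtY = ∣m+n∣m⇒∣n
    (subst (m * p ∣_) (trans (proj₂ (coeff-taylor b c (t * m) K)) (regroup X Y Z t m)) mp∣X′)
    (∣m∣n⇒∣m+n mp∣X (∣m⇒∣m*n (t * t * Z) (*-monoʳ-∣ m p∣m)))

p∣coeff₀ : ∀ {p} b c K → Prime p → ¬ p ∣ 2 → ¬ p ∣ K →
           p ∣ coeff₁ b c K → p ∣ ∂coeff₁ b c K → p ∣ coeff₀ b c K
p∣coeff₀ {p} b c K p-prime p∤2 p∤K p∣B p∣∂B =
  ∣m*n∧∤m⇒∣n p-prime p∣2A p∤2
  where
  p∣K[bB+2A] : p ∣ K * (b * coeff₁ b c K + 2 * coeff₀ b c K)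
  p∣K[bB+2A] = subst (p ∣_) (discriminant-∂coeff₁ b c K)
                 (∣m∣n⇒∣m+n (∣n⇒∣m*n (b * b + 4 * c) p∣∂B) (∣n⇒∣m*n b p∣B))
  p∣2A : p ∣ 2 * coeff₀ b c K
  p∣2A = ∣m+n∣m⇒∣n (∣m*n∧∤m⇒∣n p-prime p∣K[bB+2A] p∤K) (∣n⇒∣m*n b p∣B)

-- The test modulo n

odd-part-pos : ∀ f {m} → 1 ≤ m → 1 ≤ proj₂ (split f m)
odd-part-pos zero    pos = pos
odd-part-pos (suc f) {suc zero}    pos = pos
odd-part-pos (suc f) {suc (suc m)} pos with suc (suc m) % 2 ≡ᵇ 0
... | true  = odd-part-pos f (m≥n⇒m/n>0 {suc (suc m)} {2} (s≤s (s≤s z≤n)))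
... | false = pos

%-cong-+ : ∀ {x x′ y y′} d .{{_ : NonZero d}} →
           x % d ≡ x′ % d → y % d ≡ y′ % d → (x + y) % d ≡ (x′ + y′) % d
%-cong-+ {x} {x′} {y} {y′} d ex ey = begin
  (x + y) % d              ≡⟨ %-distribˡ-+ x y d ⟩
  (x % d + y % d) % d      ≡⟨ cong₂ (λ u v → (u + v) % d) ex ey ⟩
  (x′ % d + y′ % d) % d    ≡⟨ %-distribˡ-+ x′ y′ d ⟨
  (x′ + y′) % d            ∎
  where open ≡-Reasoning

%-cong-*ˡ : ∀ {x y} a d .{{_ : NonZero d}} → x % d ≡ y % d → (a * x) % d ≡ (a * y) % d
%-cong-*ˡ {x} {y} a d e = begin
  (a * x) % d              ≡⟨ %-distribˡ-* a x d ⟩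
  (a % d * (x % d)) % d    ≡⟨ cong (λ u → (a % d * u) % d) e ⟩
  (a % d * (y % d)) % d    ≡⟨ %-distribˡ-* a y d ⟨
  (a * y) % d              ∎
  where open ≡-Reasoning

eqR-sound : ∀ n .{{_ : NonZero n}} {r r′ : R n} → T (eqR n r r′) → r ≡ r′
eqR-sound n {u , v} {u′ , v′} eq with Equivalence.to T-∧ eq
... | eqᵤ , eqᵥ = cong₂ _,_ (≡ᵇ⇒≡ u u′ eqᵤ) (≡ᵇ⇒≡ v v′ eqᵥ)

passes⇒steps : ∀ n .{{_ : NonZero n}} B b c → T (passesQFT n B b c) →
               T (qftParams n b c) × T (step4 n b c) × T (step5 n b c)
passes⇒steps n B b c passes
  with qftParams n b c | not (smallPrimeDiv n B) | not (isSquare n) | step3 n b c | step4 n b c | step5 n b c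
... | true | true | true | true | true | true = _ , _ , _

module _ {n : ℕ} .{{_ : NonZero n}} (1<n : 1 < n) where

  powX≡coeffs : ∀ b c k → powX n b c k ≡ (coeff₀ b c k % n , coeff₁ b c k % n)
  powX≡coeffs b c zero    = cong (1 % n ,_) (sym (m<n⇒m%n≡m (<-trans z<s 1<n)))
  powX≡coeffs b c (suc k) rewrite powX≡coeffs b c k | m<n⇒m%n≡m 1<n =
    cong₂ _,_ (%-cong-*ˡ c n (reduce (coeff₁ b c k)))
              (%-cong-+ n (reduce (coeff₀ b c k)) (%-cong-*ˡ b n (reduce (coeff₁ b c k))))
    where
    reduce : ∀ x → (1 * (x % n)) % n ≡ x % n
    reduce x = trans (cong (_% n) (*-identityˡ (x % n))) (m%n%n≡m%n x n)

  eqR-powX : ∀ {b c} k r → T (eqR n (powX n b c k) r) → (coeff₀ b c k % n , coeff₁ b c k % n) ≡ r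
  eqR-powX {b} {c} k r eq = eqR-sound n {r′ = r} (subst (λ x → T (eqR n x r)) (powX≡coeffs b c k) eq)

  step4⇒∣coeffs : ∀ {b c} → T (step4 n b c) → n ∣ coeff₁ b c (n + 1) × n ∣ coeff₀ b c (n + 1) + c
  step4⇒∣coeffs {b} {c} ok = m%n≡0⇒n∣m _ n (cong proj₂ x^[n+1]≡-c) , m%n≡0⇒n∣m _ n (begin
    (coeff₀ b c (n + 1) + c) % n  ≡⟨ %-cong-+ n (cong proj₁ x^[n+1]≡-c) (sym (m%n%n≡m%n c n)) ⟩
    (n ∸ c % n + c % n) % n       ≡⟨ cong (_% n) (m∸n+n≡m (m%n≤n c n)) ⟩
    n % n                         ≡⟨ n%n≡0 n ⟩
    0                             ∎)
    where
    open ≡-Reasoning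
    x^[n+1]≡-c : (coeff₀ b c (n + 1) % n , coeff₁ b c (n + 1) % n) ≡ negCR n c
    x^[n+1]≡-c = eqR-powX (n + 1) (negCR n c) ok

  private
    r s : ℕ
    r = proj₁ (split (n * n ∸ 1) (n * n ∸ 1))
    s = proj₂ (split (n * n ∸ 1) (n * n ∸ 1))

    1≤s : 1 ≤ s
    1≤s = odd-part-pos (n * n ∸ 1) (m<n⇒0<n∸m (<-≤-trans 1<n (m≤m*n n n)))

  module _ {p : ℕ} (p-prime : Prime p) (p∣n : p ∣ n) where

    p∣constant-of-power : ∀ {b c u v} k → 1 ≤ k → p ∣ c → T (eqR n (powX n b c k) (u , v)) → p ∣ u
    p∣constant-of-power {b} {c} {u} {v} (suc k) _ p∣c eq =
      subst (p ∣_) (cong proj₁ (eqR-powX (suc k) (u , v) eq))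
            (%-presˡ-∣ (∣m⇒∣m*n (coeff₁ b c k) p∣c) p∣n)

    private
      p∤n∸1 : ¬ p ∣ n ∸ 1
      p∤n∸1 p∣n∸1 = prime⇒∤1 p-prime (∣m+n∣m⇒∣n (subst (p ∣_) (sym (m∸n+n≡m (<⇒≤ 1<n))) p∣n) p∣n∸1)

      n∸1<n : n ∸ 1 < n
      n∸1<n = ∸-monoʳ-< z<s (<⇒≤ 1<n)

    step5⇒∤c : ∀ {b c} → T (step5 n b c) → ¬ p ∣ c
    step5⇒∤c {b} {c} ok p∣c with Equivalence.to T-∨ ok
    ... | inj₁ x^s≡1 =
      prime⇒∤1 p-prime (subst (p ∣_) (m<n⇒m%n≡m 1<n) (p∣constant-of-power s 1≤s p∣c x^s≡1))
    ... | inj₂ some with satisfied (any⁻ _ (upTo (r ∸ 1)) some)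
    ...   | j , x^2ʲs≡-1 =
      p∤n∸1 (subst (p ∣_) (m<n⇒m%n≡m n∸1<n)
                 (p∣constant-of-power (2 ^ j * s) (*-mono-≤ (m^n>0 2 j) 1≤s) p∣c x^2ʲs≡-1))

  module _ {m p : ℕ} .{{_ : NonZero m}} (p-prime : Prime p) (p∣m : p ∣ m) (n≡m*p : n ≡ m * p)
           (n-odd : n % 2 ≡ 1) where

    private
      p∣n : p ∣ n
      p∣n = subst (p ∣_) (sym n≡m*p) (n∣m*n m)

      p∤2 : ¬ p ∣ 2
      p∤2 p∣2 = prime⇒∤1 p-prime (subst (p ∣_) n-odd (%-presˡ-∣ p∣n p∣2))

      p∤n+1 : ¬ p ∣ n + 1
      p∤n+1 p∣n+1 = prime⇒∤1 p-prime (∣m+n∣m⇒∣n p∣n+1 p∣n)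

    passes-unique-mod : ∀ B b c {t} → 0 < t → t < p →
                        T (passesQFT n B b c) → ¬ T (passesQFT n B (b + t * m) c)
    passes-unique-mod B b c {t} 0<t t<p passes passes′ =
      step5⇒∤c p-prime p∣n (proj₂ (proj₂ steps)) (∣m+n∣m⇒∣n (∣-trans p∣n n∣A+c) p∣A)
      where
      steps : T (qftParams n b c) × T (step4 n b c) × T (step5 n b c)
      steps = passes⇒steps n B b c passes
      n∣B : n ∣ coeff₁ b c (n + 1)
      n∣B = proj₁ (step4⇒∣coeffs (proj₁ (proj₂ steps)))
      n∣A+c : n ∣ coeff₀ b c (n + 1) + c
      n∣A+c = proj₂ (step4⇒∣coeffs (proj₁ (proj₂ steps)))
      n∣B′ : n ∣ coeff₁ (b + t * m) c (n + 1)
      n∣B′ = proj₁ (step4⇒∣coeffs (proj₁ (proj₂ (passes⇒steps n B (b + t * m) c passes′))))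
      p∤t : ¬ p ∣ t
      p∤t p∣t = <⇒≱ t<p (∣⇒≤ {{>-nonZero 0<t}} p∣t)
      p∣A : p ∣ coeff₀ b c (n + 1)
      p∣A = p∣coeff₀ b c (n + 1) p-prime p∤2 p∤n+1 (∣-trans p∣n n∣B)
              (p∣∂coeff₁ b c (n + 1) p-prime p∣m p∤t (subst (_∣ coeff₁ b c (n + 1)) n≡m*p n∣B)
                                   (subst (_∣ coeff₁ (b + t * m) c (n + 1)) n≡m*p n∣B′))

-- Jacobi symbols

≤∧rough⇒rough : ∀ {m m′ x} → m ≤ m′ → m′ Rough x → m Rough x
≤∧rough⇒rough m≤m′ rough (hasNonTrivialDivisor d<m d∣x) =
  rough (hasNonTrivialDivisor (<-≤-trans d<m m≤m′) d∣x)

firstDiv-rough : ∀ f {d x} → x ≤ f + d → d Rough x → firstDiv f d x Rough x × firstDiv f d x ∣ x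
firstDiv-rough zero    x≤d rough = ≤∧rough⇒rough x≤d rough , ∣-refl
firstDiv-rough (suc f) {d} {x} x≤ rough with d ∣? x
... | yes d∣x = rough , d∣x
... | no  d∤x = firstDiv-rough f (subst (x ≤_) (sym (+-suc f d)) x≤) (∤⇒rough-suc d∤x rough)

firstDiv-≥2 : ∀ f {d x} → 2 ≤ d → 2 ≤ x → 2 ≤ firstDiv f d x
firstDiv-≥2 zero    2≤d 2≤x = 2≤x
firstDiv-≥2 (suc f) {d} {x} 2≤d 2≤x with d ∣? x
... | yes _ = 2≤d
... | no  _ = firstDiv-≥2 f (≤-trans 2≤d (n≤1+n d)) 2≤x

spf-rough : ∀ x → spf x Rough x
spf-rough x = proj₁ (firstDiv-rough x (m≤m+n x 2) 2-rough)

spf-∣ : ∀ x → spf x ∣ x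
spf-∣ x = proj₂ (firstDiv-rough x (m≤m+n x 2) 2-rough)

spf-prime : ∀ x → 2 ≤ x → Prime (spf x)
spf-prime x 2≤x =
  rough∧∣⇒prime {{n>1⇒nonTrivial (firstDiv-≥2 x ≤-refl 2≤x)}} (spf-rough x) (spf-∣ x)

legendre-cong : ∀ a a′ q .{{_ : NonZero q}} → a % q ≡ a′ % q → legendre a q ≡ legendre a′ q
legendre-cong a a′ (suc k) e rewrite e = refl

jacGo-cong : ∀ f {d} x y {z} .{{_ : NonZero d}} → (∀ {q} → Prime q → q ∣ z → q ∣ d) →
             x % d ≡ y % d → jacGo f x z ≡ jacGo f y z
jacGo-cong zero             x y     primes⊆ e = refl
jacGo-cong (suc f) {d} x y {z} primes⊆ e with z ≤ᵇ 1 in z≤ᵇ1 | spf z in spf≡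
... | true  | _     = refl
... | false | zero  = refl
... | false | suc k = cong₂ _*ℤ_ (legendre-cong x y (suc k) x≡y[q])
    (jacGo-cong f x y (λ q-prime q∣z/q → primes⊆ q-prime (∣-trans q∣z/q (m/n∣m q∣z))) e)
  where
  q∣z : suc k ∣ z
  q∣z = subst (_∣ z) spf≡ (spf-∣ z)
  q∣d : suc k ∣ d
  q∣d = primes⊆ (subst Prime spf≡ (spf-prime z (≰⇒> (λ z≤1 → subst T z≤ᵇ1 (≤⇒≤ᵇ z≤1))))) q∣z
  x≡y[q] : x % suc k ≡ y % suc k
  x≡y[q] = trans (sym (m∣n⇒o%n%m≡o%m (suc k) d x q∣d))
                 (trans (cong (_% suc k) e) (m∣n⇒o%n%m≡o%m (suc k) d y q∣d))

qftParams-periodic : ∀ {n m} .{{_ : NonZero n}} .{{_ : NonZero m}} →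
                     m ∣ n → (∀ {q} → Prime q → q ∣ n → q ∣ m) →
                     ∀ i b c → qftParams n (i * m + b) c ≡ qftParams n b c
qftParams-periodic {n} {m} m∣n primes⊆ i b c =
  cong (λ j → (j ==ℤ -1ℤ) ∧ (jacobi ((n ∸ (c % n)) % n) n ==ℤ 1ℤ))
       (jacGo-cong n {m} (((i * m + b) * (i * m + b) + 4 * c) % n) ((b * b + 4 * c) % n) primes⊆ (begin
    ((i * m + b) * (i * m + b) + 4 * c) % n % m    ≡⟨ m∣n⇒o%n%m≡o%m m n _ m∣n ⟩
    ((i * m + b) * (i * m + b) + 4 * c) % m        ≡⟨ cong (_% m) (expand i m b c) ⟩
    (b * b + 4 * c + i * (i * m + 2 * b) * m) % m  ≡⟨ [m+kn]%n≡m%n _ (i * (i * m + 2 * b)) m ⟩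
    (b * b + 4 * c) % m                            ≡⟨ m∣n⇒o%n%m≡o%m m n _ m∣n ⟨
    (b * b + 4 * c) % n % m                        ∎))
  where
  open ≡-Reasoning
  expand : ∀ i m b c → (i * m + b) * (i * m + b) + 4 * c ≡ b * b + 4 * c + i * (i * m + 2 * b) * m
  expand = solve-∀

-- Counting

inM : ∀ n .{{_ : NonZero n}} → ℕ → ℕ → Bool
inM n b c = qftParams n b c ∨ nontrivGcd n (b * b + 4 * c) ∨ nontrivGcd n c

module _ {n m p : ℕ} .{{_ : NonZero n}} .{{_ : NonZero m}} (1<n : 1 < n) (n-odd : n % 2 ≡ 1)
         (p-prime : Prime p) (p∣m : p ∣ m) (n≡m*p : n ≡ m * p) where

  private
    n≡p*m : n ≡ p * m
    n≡p*m = trans n≡m*p (*-comm m p)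

    1<p : 1 < p
    1<p = nonTrivial⇒n>1 p {{prime⇒nonTrivial p-prime}}

    p∣n : p ∣ n
    p∣n = subst (p ∣_) (sym n≡p*m) (∣m⇒∣m*n m ∣-refl)

    periodic : ∀ i b c → qftParams n (i * m + b) c ≡ qftParams n b c
    periodic = qftParams-periodic (subst (m ∣_) (sym n≡m*p) (m∣m*n p))
                 (λ q-prime q∣n → ∣m*p⇒∣m p-prime q-prime p∣m (subst (_ ∣_) n≡m*p q∣n))

    count-by-classes : ∀ (P : ℕ × ℕ → Bool) →
      count P (pairs n) ≡ (∑[ j < m ] ∑[ c < n ] ∑[ i < p ] 𝟙 (P (i * m + j , c)))
    count-by-classes P = trans (count-pairs P n)
      (trans (cong (λ k → ∑[ b < k ] ∑[ c < n ] 𝟙 (P (b , c))) n≡p*m)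
             (∑-residue-classes p m n (λ b c → 𝟙 (P (b , c)))))

  class-bound : ∀ B j c →
    p * (∑[ i < p ] 𝟙 (passesQFT n B (i * m + j) c)) ≤ (∑[ i < p ] 𝟙 (inM n (i * m + j) c))
  class-bound B j c = unique⇒*-∑𝟙-≤ p _ _ once spread
    where
    shift : ∀ {i i′} → i ≤ i′ → i * m + j + (i′ ∸ i) * m ≡ i′ * m + j
    shift {i} {i′} i≤i′ = begin
      i * m + j + (i′ ∸ i) * m  ≡⟨ regroup i (i′ ∸ i) m j ⟩
      (i + (i′ ∸ i)) * m + j    ≡⟨ cong (λ k → k * m + j) (m+[n∸m]≡n i≤i′) ⟩
      i′ * m + j                ∎
      where
      open ≡-Reasoning
      regroup : ∀ a b m j → a * m + j + b * m ≡ (a + b) * m + j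
      regroup = solve-∀
    once : ∀ i i′ → i < i′ → i′ < p →
           T (passesQFT n B (i * m + j) c) → ¬ T (passesQFT n B (i′ * m + j) c)
    once i i′ i<i′ i′<p passes passes′ =
      passes-unique-mod 1<n p-prime p∣m n≡m*p n-odd B (i * m + j) c
        (m<n⇒0<n∸m i<i′) (≤-<-trans (m∸n≤m i′ i) i′<p) passes
        (subst (λ b → T (passesQFT n B b c)) (sym (shift (<⇒≤ i<i′))) passes′)
    spread : ∀ i i′ → i < p → i′ < p → T (passesQFT n B (i * m + j) c) → T (inM n (i′ * m + j) c)
    spread i i′ _ _ passes = T-∨ˡ _ (subst T (trans (periodic i j c) (sym (periodic i′ j c)))
                                           (proj₁ (passes⇒steps n B (i * m + j) c passes)))

  p*passCount≤M : ∀ B → p * passCount n B ≤ M n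
  p*passCount≤M B = begin
    p * passCount n B
      ≡⟨ cong (p *_) (count-by-classes _) ⟩
    p * (∑[ j < m ] ∑[ c < n ] ∑[ i < p ] 𝟙 (passesQFT n B (i * m + j) c))
      ≡⟨ trans (*-distribˡ-∑ p m _) (∑-cong m (λ j _ → *-distribˡ-∑ p n _)) ⟩
    (∑[ j < m ] ∑[ c < n ] p * (∑[ i < p ] 𝟙 (passesQFT n B (i * m + j) c)))
      ≤⟨ ∑-mono-≤ m (λ j _ → ∑-mono-≤ n (λ c _ → class-bound B j c)) ⟩
    (∑[ j < m ] ∑[ c < n ] ∑[ i < p ] 𝟙 (inM n (i * m + j) c))
      ≡⟨ count-by-classes _ ⟨
    M n ∎
    where open ≤-Reasoning

  0<M : 0 < M n
  0<M = begin-strict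
    0                                      <⟨ T⇒1≤𝟙 inM[0,p] ⟩
    𝟙 (inM n 0 p)                          ≤⟨ term≤∑ n (𝟙 ∘ inM n 0) p<n ⟩
    (∑[ c < n ] 𝟙 (inM n 0 c))             ≤⟨ term≤∑ n (λ b → ∑[ c < n ] 𝟙 (inM n b c)) 0<n ⟩
    (∑[ b < n ] ∑[ c < n ] 𝟙 (inM n b c))  ≡⟨ count-pairs _ n ⟨
    M n                                    ∎
    where
    open ≤-Reasoning
    0<n : 0 < n
    0<n = <-trans z<s 1<n
    p<n : p < n
    p<n = subst (p <_) (sym n≡p*m) (m<m*n p m {{prime⇒nonZero p-prime}} (<-≤-trans 1<p (∣⇒≤ p∣m)))
    gcd[p,n]≡p : gcd p n ≡ p
    gcd[p,n]≡p = ∣-antisym (gcd[m,n]∣m p n) (gcd-greatest ∣-refl p∣n)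
    inM[0,p] : T (inM n 0 p)
    inM[0,p] = T-∨ʳ (qftParams n 0 p) (T-∨ʳ (nontrivGcd n (0 * 0 + 4 * p))
      (subst (λ g → T ((1 <ᵇ g) ∧ (g <ᵇ n))) (sym gcd[p,n]≡p)
             (Equivalence.from T-∧ (<⇒<ᵇ 1<p , <⇒<ᵇ p<n))))

lemma2p7 : (B : ℕ) → 1 ≤ B → (n : ℕ) → .{{_ : NonZero n}} → n % 2 ≡ 1 → 1 < n →
           (p : ℕ) → Prime p → p ^ 2 ∣ n →
           passCount n B * p < 4 * M n
lemma2p7 B _ n n-odd 1<n p p-prime (divides q n≡q*p²) = begin-strict
  passCount n B * p  ≡⟨ *-comm (passCount n B) p ⟩
  p * passCount n B  ≤⟨ p*passCount≤M 1<n n-odd p-prime p∣m n≡m*p B ⟩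
  M n                <⟨ m<m*n (M n) 4 {{>-nonZero 0<Mn}} (s≤s (s≤s z≤n)) ⟩
  M n * 4            ≡⟨ *-comm (M n) 4 ⟩
  4 * M n            ∎
  where
  open ≤-Reasoning
  m : ℕ
  m = q * p
  p∣m : p ∣ m
  p∣m = n∣m*n q
  n≡m*p : n ≡ m * p
  n≡m*p = trans n≡q*p² (trans (cong (λ x → q * (p * x)) (*-identityʳ p)) (sym (*-assoc q p p)))
  instance
    m≢0 : NonZero m
    m≢0 = m*n≢0⇒m≢0 m {{subst NonZero n≡m*p it}}
  0<Mn : 0 < M n
  0<Mn = 0<M 1<n n-odd p-prime p∣m n≡m*p
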